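{- Let $G=(V,E)$ be a graph with $n$ nodes and $m$ edges, and let $\mathcal{S}=a_1:\ldots:a_\ell$ be a hierarchy with integers $a_i\ge 2$ and $k=\prod_{i=1}^{\ell}a_i$. Online recursive multi-section along $\mathcal{S}$ coupled with Fennel or LDG as the scoring rule has time complexity $O\big(m\ell + n\sum_{i=1}^{\ell}a_i\big)$.
   Context: One-pass streaming model: nodes of $G$ arrive one at a time together with their neighborhood $N(u)$ and must be permanently assigned to a block on arrival. A hierarchy $\mathcal{S}=a_1:\ldots:a_\ell$ defines a tree of blocks: layer $\ell$ has $a_\ell$ blocks; each block of layer $i>1$ has $a_{i-1}$ sub-blocks in layer $i-1$; layer $1$ contains the $k$ final blocks. Online recursive multi-section: when node $u$ arrives, for $i=\ell,\ldots,1$ it chooses among the $a_i$ candidate blocks of layer $i$ (all top-layer blocks if $i=\ell$, otherwise the sub-blocks of the block chosen at layer $i+1$) the one maximizing a score, and assigns $u$ to it; weights of all blocks at all layers are maintained. Scores for a candidate block $W$ in layer $i$: Fennel uses $|W\cap N(u)|-\alpha_i\gamma|W|^{\gamma-1}$ (constants $\alpha_i,\gamma$); LDG uses $|W\cap N(u)|\,(1-|W|/L_i)$ with $L_i$ the block capacity at layer $i$. Assigning a node in one layer with these rules costs $O(|N(u)|+a_i)$ time. -}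

module Defs where

open import Data.Nat using (ℕ; zero; suc; _+_; _*_; _≤_; NonZero)
open import Data.Bool using (Bool; true; false; _∧_; if_then_else_; not)
open import Data.Fin using (Fin)
open import Data.Fin.Properties using () renaming (_≟_ to _≟ᶠ_)
open import Data.List using (List; []; _∷_; _++_; [_]; length; map; filterᵇ; upTo; reverse; zip)
open import Data.Bool.ListAction using (any)
open import Data.Product using (_×_; _,_; proj₁; proj₂)
open import Data.Integer using (+_)
open import Data.Rational using (ℚ; _-_; _≤ᵇ_) renaming (_*_ to _*ℚ_; _/_ to _/ℚ_)
open import Relation.Nullary.Decidable using (⌊_⌋)

record Graph : Set where
  field
    n     : ℕ
    edges : List (Fin n × Fin n)

open Graph public

m : Graph → ℕ
m G = length (edges G)

N : (G : Graph) → Fin (n G) → List (Fin (n G))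
N G u = map proj₂ (filterᵇ (λ e → ⌊ u ≟ᶠ proj₁ e ⌋) (edges G))
     ++ map proj₁ (filterᵇ (λ e → ⌊ u ≟ᶠ proj₂ e ⌋) (edges G))

-- Scoring rules (score of a candidate block W in layer i, given
-- c = |W ∩ N(u)| and w = |W|).

data Rule : Set where
  -- Fennel: c - α_i γ |W|^(γ-1).  'pw w' stands for |W|^(γ-1).
  fennel : (α : ℕ → ℚ) (γ : ℚ) (pw : ℕ → ℚ) → Rule
  ldg    : (L : ℕ → ℕ) → (∀ i → NonZero (L i)) → Rule

score : Rule → (i c w : ℕ) → ℚ
score (fennel α γ pw) i c w = (+ c /ℚ 1) - (α i *ℚ γ) *ℚ pw w
score (ldg L nz)      i c w = (+ c /ℚ 1) *ℚ ((+ 1 /ℚ 1) - _/ℚ_ (+ w) (L i) {{nz i}})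

-- Blocks are identified by their path in the block tree (choices from the
-- top layer ℓ downward). A node's state entry records its final-block path.

isPrefix : List ℕ → List ℕ → Bool
isPrefix []       _        = true
isPrefix (_ ∷ _)  []       = false
isPrefix (x ∷ xs) (y ∷ ys) = ⌊ x Data.Nat.≟ y ⌋ ∧ isPrefix xs ys

module _ {n : ℕ} where

  State : Set
  State = List (Fin n × List ℕ)

  weight : State → List ℕ → ℕ
  weight st p = length (filterᵇ (λ x → isPrefix p (proj₂ x)) st)

  nbrCount : State → List ℕ → List (Fin n) → ℕ
  nbrCount st p Nu =
    length (filterᵇ (λ v → any (λ x → ⌊ v ≟ᶠ proj₁ x ⌋ ∧ isPrefix p (proj₂ x)) st) Nu)

argmax : (ℕ → ℚ) → List ℕ → ℕ
argmax f []       = 0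
argmax f (j ∷ js) = go j js
  where
  go : ℕ → List ℕ → ℕ
  go b []       = b
  go b (x ∷ xs) = if f x ≤ᵇ f b then go b xs else go x xs

-- layers in processing order: (i , a_i) for i = ℓ, …, 1
layers : List ℕ → List (ℕ × ℕ)
layers as = reverse (zip (map suc (upTo (length as))) as)

-- Descend through the layers for one node; returns its path and the cost
-- charged by the cost model: |N(u)| + a_i per layer i.
descend : ∀ {n} → Rule → State {n} → List (Fin n) → List ℕ → List (ℕ × ℕ)
        → List ℕ × ℕ
descend r st Nu p []             = p , 0
descend r st Nu p ((i , a) ∷ ls) =
  let j   = argmax (λ j → score r i (nbrCount st (p ++ [ j ]) Nu)
                                    (weight st (p ++ [ j ]))) (upTo a)
      res = descend r st Nu (p ++ [ j ]) ls
  in proj₁ res , (length Nu + a) + proj₂ res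

run : (G : Graph) → Rule → List ℕ → State {n G} → List (Fin (n G)) → State {n G} × ℕ
run G r as st []       = st , 0
run G r as st (u ∷ us) =
  let d   = descend r st (N G u) [] (layers as)
      res = run G r as (st ++ [ (u , proj₁ d) ]) us
  in proj₁ res , proj₂ d + proj₂ res

totalCost : (G : Graph) → Rule → List ℕ → List (Fin (n G)) → ℕ
totalCost G r as order = proj₂ (run G r as [] order)

{-# OPTIONS --safe #-}
module Submission where

-- Each node u pays |N(u)| + a_i in each of the ℓ layers, i.e. ℓ·|N(u)| + Σ a_i
-- in total. Summing over the n nodes of the stream and using the handshake
-- lemma Σ_u |N(u)| = 2m gives exactly 2mℓ + n·Σ a_i.

open import Defs
open import Data.Bool using (Bool; true; false; if_then_else_)
open import Data.Nat using (ℕ; zero; suc; pred; _+_; _*_; _≤_)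
open import Data.Nat.Properties using (+-commutativeSemigroup; *-zeroʳ; *-distribˡ-+; +-monoʳ-≤; m≤m+n; module ≤-Reasoning)
open import Data.Nat.ListAction using (sum)
open import Data.Nat.ListAction.Properties using (sum-↭)
open import Data.Nat.Tactic.RingSolver using (solve-∀)
open import Algebra.Properties.CommutativeSemigroup +-commutativeSemigroup using () renaming (interchange to +-interchange)
open import Data.Fin using (Fin)
open import Data.Fin.Properties using (_≟_; suc-injective)
open import Data.List using (List; []; _∷_; length; map; filterᵇ; zip; reverse; upTo; tabulate; allFin)
open import Data.List.Properties using (length-++; length-map; length-upTo; map-tabulate; length-tabulate; tabulate-cong; map-cong)
open import Data.List.Relation.Unary.All using (All)
open import Data.List.Relation.Binary.Permutation.Propositional using (_↭_; ↭-trans; ↭-reflexive)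
open import Data.List.Relation.Binary.Permutation.Propositional.Properties using (↭-reverse; map⁺; ↭-length)
open import Data.Product using (Σ; _×_; _,_; proj₁; proj₂)
open import Relation.Nullary.Decidable using (⌊_⌋; ⌊⌋-map′)
open import Relation.Binary.PropositionalEquality using (_≡_; refl; sym; trans; cong; cong₂; module ≡-Reasoning)

⟦_⟧ : Bool → ℕ
⟦ b ⟧ = if b then 1 else 0

module _ {A : Set} where

  sum-map-cong : {f g : A → ℕ} → (∀ x → f x ≡ g x) → ∀ xs → sum (map f xs) ≡ sum (map g xs)
  sum-map-cong f≗g xs = cong sum (map-cong f≗g xs)

  sum-map-+ : (f g : A → ℕ) → ∀ xs → sum (map (λ x → f x + g x) xs) ≡ sum (map f xs) + sum (map g xs)
  sum-map-+ f g []       = refl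
  sum-map-+ f g (x ∷ xs) =
    trans (cong (f x + g x +_) (sum-map-+ f g xs)) (+-interchange (f x) (g x) _ _)

  sum-map-*ˡ : ∀ k (f : A → ℕ) xs → sum (map (λ x → k * f x) xs) ≡ k * sum (map f xs)
  sum-map-*ˡ k f []       = sym (*-zeroʳ k)
  sum-map-*ˡ k f (x ∷ xs) = trans (cong (k * f x +_) (sum-map-*ˡ k f xs)) (sym (*-distribˡ-+ k (f x) _))

  sum-map-const : ∀ c (xs : List A) → sum (map (λ _ → c) xs) ≡ length xs * c
  sum-map-const c []       = refl
  sum-map-const c (x ∷ xs) = cong (c +_) (sum-map-const c xs)

  length-filterᵇ-∷ : (p : A → Bool) → ∀ x xs →
                     length (filterᵇ p (x ∷ xs)) ≡ ⟦ p x ⟧ + length (filterᵇ p xs)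
  length-filterᵇ-∷ p x xs with p x
  ... | true  = refl
  ... | false = refl

sum-tabulate-const : ∀ n c → sum (tabulate {n = n} (λ _ → c)) ≡ n * c
sum-tabulate-const zero    c = refl
sum-tabulate-const (suc n) c = cong (c +_) (sum-tabulate-const n c)

-- ⌊_⌋ is isYes, which does not compute through the map′ in suc x ≟ suc y.
sum-tabulate-⟦≟⟧ : ∀ {n} (x : Fin n) → sum (tabulate (λ u → ⟦ ⌊ u ≟ x ⌋ ⟧)) ≡ 1
sum-tabulate-⟦≟⟧ {suc n} Fin.zero    = cong suc (trans (sum-tabulate-const n 0) (*-zeroʳ n))
sum-tabulate-⟦≟⟧ {suc n} (Fin.suc x) =
  trans (cong sum (tabulate-cong (λ u → cong ⟦_⟧ (⌊⌋-map′ (cong Fin.suc) suc-injective (u ≟ x)))))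
        (sum-tabulate-⟦≟⟧ x)

sum-allFin-⟦≟⟧ : ∀ {n} (x : Fin n) → sum (map (λ u → ⟦ ⌊ u ≟ x ⌋ ⟧) (allFin n)) ≡ 1
sum-allFin-⟦≟⟧ {n} x = trans (cong sum (map-tabulate {n = n} (λ u → u) (λ u → ⟦ ⌊ u ≟ x ⌋ ⟧))) (sum-tabulate-⟦≟⟧ x)

sum-length-filter-≟ : ∀ {n} {B : Set} (sel : B → Fin n) (es : List B) →
  sum (map (λ u → length (filterᵇ (λ e → ⌊ u ≟ sel e ⌋) es)) (allFin n)) ≡ length es
sum-length-filter-≟ {n} sel [] = trans (sum-map-const 0 (allFin n)) (*-zeroʳ (length (allFin n)))
sum-length-filter-≟ {n} sel (e ∷ es) = begin
  sum (map (λ u → length (filterᵇ (λ e → ⌊ u ≟ sel e ⌋) (e ∷ es))) (allFin n))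
    ≡⟨ sum-map-cong (λ u → length-filterᵇ-∷ (λ e → ⌊ u ≟ sel e ⌋) e es) (allFin n) ⟩
  sum (map (λ u → ⟦ ⌊ u ≟ sel e ⌋ ⟧ + length (filterᵇ (λ e → ⌊ u ≟ sel e ⌋) es)) (allFin n))
    ≡⟨ sum-map-+ _ _ (allFin n) ⟩
  sum (map (λ u → ⟦ ⌊ u ≟ sel e ⌋ ⟧) (allFin n))
    + sum (map (λ u → length (filterᵇ (λ e → ⌊ u ≟ sel e ⌋) es)) (allFin n))
    ≡⟨ cong₂ _+_ (sum-allFin-⟦≟⟧ (sel e)) (sum-length-filter-≟ sel es) ⟩
  suc (length es) ∎
  where open ≡-Reasoning

handshake : (G : Graph) → sum (map (λ u → length (N G u)) (allFin (n G))) ≡ m G + m G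
handshake G = begin
  sum (map (λ u → length (N G u)) (allFin (n G)))
    ≡⟨ sum-map-cong degree-split (allFin (n G)) ⟩
  sum (map (λ u → out u + inc u) (allFin (n G)))
    ≡⟨ sum-map-+ out inc (allFin (n G)) ⟩
  sum (map out (allFin (n G))) + sum (map inc (allFin (n G)))
    ≡⟨ cong₂ _+_ (sum-length-filter-≟ proj₁ (edges G)) (sum-length-filter-≟ proj₂ (edges G)) ⟩
  m G + m G ∎
  where
  open ≡-Reasoning
  from to : Fin (n G) → List (Fin (n G) × Fin (n G))
  from u = filterᵇ (λ e → ⌊ u ≟ proj₁ e ⌋) (edges G)
  to   u = filterᵇ (λ e → ⌊ u ≟ proj₂ e ⌋) (edges G)
  out inc : Fin (n G) → ℕ
  out u = length (from u)
  inc u = length (to u)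
  degree-split : ∀ u → length (N G u) ≡ out u + inc u
  degree-split u =
    trans (length-++ (map proj₂ (from u))) (cong₂ _+_ (length-map proj₂ (from u)) (length-map proj₁ (to u)))

map-proj₂-zip : ∀ {A B : Set} (xs : List A) (ys : List B) →
                length xs ≡ length ys → map proj₂ (zip xs ys) ≡ ys
map-proj₂-zip []       []       _   = refl
map-proj₂-zip (x ∷ xs) (y ∷ ys) len = cong (y ∷_) (map-proj₂-zip xs ys (cong pred len))

layer-sizes : ∀ as → map proj₂ (layers as) ↭ as
layer-sizes as = ↭-trans (map⁺ proj₂ (↭-reverse indexed))
  (↭-reflexive (map-proj₂-zip (map suc (upTo (length as))) as
    (trans (length-map suc (upTo (length as))) (length-upTo (length as)))))
  where indexed = zip (map suc (upTo (length as))) as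

descend-cost : ∀ {n} r (st : State {n}) Nu p ls →
               proj₂ (descend r st Nu p ls) ≡ sum (map (λ l → length Nu + proj₂ l) ls)
descend-cost r st Nu p []             = refl
descend-cost r st Nu p ((i , a) ∷ ls) = cong (length Nu + a +_) (descend-cost r st Nu _ ls)

layers-cost : ∀ c as → sum (map (λ l → c + proj₂ l) (layers as)) ≡ length as * c + sum as
layers-cost c as = begin
  sum (map (λ l → c + proj₂ l) (layers as))
    ≡⟨ sum-map-+ (λ _ → c) proj₂ (layers as) ⟩
  sum (map (λ _ → c) (layers as)) + sum (map proj₂ (layers as))
    ≡⟨ cong₂ _+_ (sum-map-const c (layers as)) (sum-↭ (layer-sizes as)) ⟩
  length (layers as) * c + sum as
    ≡⟨ cong (λ ℓ → ℓ * c + sum as) (trans (sym (length-map proj₂ (layers as))) (↭-length (layer-sizes as))) ⟩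
  length as * c + sum as ∎
  where open ≡-Reasoning

run-cost : ∀ G r as (st : State {n G}) us →
           proj₂ (run G r as st us) ≡ sum (map (λ u → length as * length (N G u) + sum as) us)
run-cost G r as st []       = refl
run-cost G r as st (u ∷ us) =
  cong₂ _+_ (trans (descend-cost r st (N G u) [] (layers as)) (layers-cost (length (N G u)) as))
            (run-cost G r as _ us)

totalCost≡ : ∀ G r as (order : List (Fin (n G))) → order ↭ allFin (n G) →
             totalCost G r as order ≡ length as * (m G + m G) + n G * sum as
totalCost≡ G r as order perm = begin
  totalCost G r as order
    ≡⟨ run-cost G r as [] order ⟩
  sum (map (λ u → length as * deg u + sum as) order)
    ≡⟨ sum-map-+ _ _ order ⟩
  sum (map (λ u → length as * deg u) order) + sum (map (λ _ → sum as) order)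
    ≡⟨ cong₂ _+_ (sum-map-*ˡ (length as) deg order) (sum-map-const (sum as) order) ⟩
  length as * sum (map deg order) + length order * sum as
    ≡⟨ cong₂ (λ d k → length as * d + k * sum as)
         (trans (sum-↭ (map⁺ deg perm)) (handshake G))
         (trans (↭-length perm) (length-tabulate {n = n G} (λ u → u))) ⟩
  length as * (m G + m G) + n G * sum as ∎
  where
  open ≡-Reasoning
  deg : Fin (n G) → ℕ
  deg u = length (N G u)

theorem2 : Σ ℕ λ C → (G : Graph) (as : List ℕ) → All (λ a → 2 ≤ a) as
           → (order : List (Fin (n G))) → order ↭ allFin (n G)
           → (r : Rule)
           → totalCost G r as order ≤ C * (m G * length as + n G * sum as)
theorem2 = 2 , λ G as _ order perm r → begin
  totalCost G r as order                                      ≡⟨ totalCost≡ G r as order perm ⟩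
  length as * (m G + m G) + n G * sum as                      ≤⟨ +-monoʳ-≤ (length as * (m G + m G)) (m≤m+n (n G * sum as) _) ⟩
  length as * (m G + m G) + (n G * sum as + n G * sum as)     ≡⟨ regroup (length as) (m G) (n G * sum as) ⟩
  2 * (m G * length as + n G * sum as)                        ∎
  where
  open ≤-Reasoning
  regroup : ∀ ℓ e c → ℓ * (e + e) + (c + c) ≡ 2 * (e * ℓ + c)
  regroup = solve-∀
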